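{- Let $p$ be a prime, $q=p^r>2$, let $\beta$ be a generator of $\mathbb{F}_q^*$, let $m$ be an integer with $1<m<q-1$, coprime with $q-1$, and with $m\not\equiv p^l\pmod{q-1}$ for all $l\in\{0,\ldots,r-1\}$, and let $c\in\mathbb{F}_q^*$ be such that $x^m-x+\frac{c}{1-\beta}=0$ has no solution in $\mathbb{F}_q$. Let $Q=\mathbb{F}_q$ with $x\ast y=(1-\beta)x^m+\beta y+c$. Then the number of associative triples in $Q$, i.e. triples $(x,y,z)\in Q^3$ with $(x\ast y)\ast z=x\ast(y\ast z)$, equals $q^2=|Q|^2$. -}

module Defs where

open import Level using (0ℓ)
open import Data.Nat as ℕ using (ℕ; zero; suc)
open import Data.Fin using (Fin)
open import Data.Fin.Properties using () renaming (_≟_ to _≟ᶠ_)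
open import Data.List using (List; length; filter; map; concatMap; allFin)
open import Data.Product using (_×_; _,_; ∃)
open import Algebra.Core using (Op₁; Op₂)
open import Algebra.Structures using (IsCommutativeRing)
open import Function.Bundles using (_↔_; Inverse)
open import Relation.Binary.PropositionalEquality using (_≡_; _≢_; cong)
open import Relation.Nullary using (Dec; yes; no)

record FiniteField (q : ℕ) : Set₁ where
  infixl 6 _+_
  infixl 7 _*_
  field
    Carrier : Set
    _+_ _*_ : Op₂ Carrier
    -_ : Op₁ Carrier
    0# 1# : Carrier
    isCommutativeRing : IsCommutativeRing _≡_ _+_ _*_ -_ 0# 1#
    _⁻¹ : Op₁ Carrier
    0≢1 : 0# ≢ 1#
    ⁻¹-inverse : ∀ x → x ≢ 0# → x * (x ⁻¹) ≡ 1#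
    enumeration : Fin q ↔ Carrier

  infixl 6 _-_
  _-_ : Op₂ Carrier
  x - y = x + (- y)

  infixr 8 _^ᶠ_
  _^ᶠ_ : Carrier → ℕ → Carrier
  x ^ᶠ zero = 1#
  x ^ᶠ suc n = x * (x ^ᶠ n)

  elements : List Carrier
  elements = map (Inverse.to enumeration) (allFin q)

  _≟_ : (x y : Carrier) → Dec (x ≡ y)
  x ≟ y with Inverse.from enumeration x ≟ᶠ Inverse.from enumeration y
  ... | yes e = yes (begin)
    where
    open Relation.Binary.PropositionalEquality using (trans; sym)
    begin : x ≡ y
    begin = trans (sym (Inverse.strictlyInverseˡ enumeration x))
              (trans (cong (Inverse.to enumeration) e)
                     (Inverse.strictlyInverseˡ enumeration y))
  ... | no ne = no (λ e → ne (cong (Inverse.from enumeration) e))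

  IsGenerator : Carrier → Set
  IsGenerator β = β ≢ 0# × (∀ x → x ≢ 0# → ∃ λ k → β ^ᶠ k ≡ x)

  triples : List (Carrier × Carrier × Carrier)
  triples = concatMap (λ x → concatMap (λ y → map (λ z → x , y , z) elements) elements) elements

  numAssociativeTriples : Op₂ Carrier → ℕ
  numAssociativeTriples _∗_ =
    length (filter (λ { (x , y , z) → ((x ∗ y) ∗ z) ≟ (x ∗ (y ∗ z)) }) triples)

-- A
-- generator β of F_q^* is ≠ 1 because q > 2.
module Submission where

open import Defs
open import Data.Nat using (ℕ; _<_; _∸_; _^_)
open import Data.Nat.Primality using (Prime)
open import Data.Nat.Coprimality using (Coprime)
open import Data.Integer using (+_) renaming (_-_ to _-ℤ_)
open import Data.Integer.Divisibility using (_∣_)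
open import Data.Product using (∃)
open import Relation.Binary.PropositionalEquality using (_≡_; _≢_)
open import Relation.Nullary using (¬_)

import Data.Nat as ℕ
open import Data.Fin using (Fin; zero; suc)
open import Data.Fin.Properties using (0≢1+n; suc-injective; pigeonhole; <⇒≢)
open import Data.List using (List; []; _∷_; length; filter; map; concatMap; tabulate; allFin; _++_)
open import Data.List.Properties
  using (filter-accept; filter-reject; filter-++; length-++; length-map; length-tabulate; map-tabulate)
open import Data.Product using (∃!; _×_; _,_)
open import Function using (_∘_; id; _⇔_; mk⇔; _↔_; Inverse; Injection; Equivalence)
open import Function.Properties.Inverse using (↔⇒↣)
open import Relation.Unary using (Pred; Decidable)
open import Relation.Nullary using (yes; no)
open import Relation.Binary.PropositionalEquality using (refl; sym; trans; cong; cong₂; subst; module ≡-Reasoning)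
open import Algebra.Bundles using (CommutativeRing)

module Counting {a} {A : Set a} {P : Pred A a} (P? : Decidable P) where

  length-filter-tabulate-none : ∀ {n} (g : Fin n → A) → (∀ i → ¬ P (g i)) →
    length (filter P? (tabulate g)) ≡ 0
  length-filter-tabulate-none {ℕ.zero} g ¬P = refl
  length-filter-tabulate-none {ℕ.suc n} g ¬P
    rewrite filter-reject P? {xs = tabulate (g ∘ suc)} (¬P zero) =
    length-filter-tabulate-none (g ∘ suc) (¬P ∘ suc)

  length-filter-tabulate-unique : ∀ {n} (g : Fin n → A) → ∃! _≡_ (P ∘ g) →
    length (filter P? (tabulate g)) ≡ 1
  length-filter-tabulate-unique g (zero , Pg₀ , unique)
    rewrite filter-accept P? {xs = tabulate (g ∘ suc)} Pg₀ =
    cong ℕ.suc (length-filter-tabulate-none (g ∘ suc) (λ i Pgi → 0≢1+n (unique Pgi)))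
  length-filter-tabulate-unique g (suc k , Pgk , unique)
    rewrite filter-reject P? {xs = tabulate (g ∘ suc)} (λ Pg₀ → 0≢1+n (sym (unique Pg₀))) =
    length-filter-tabulate-unique (g ∘ suc) (k , Pgk , suc-injective ∘ unique)

  length-filter-concatMap : ∀ {B : Set a} (f : B → List A) {k} →
    (∀ x → length (filter P? (f x)) ≡ k) →
    ∀ xs → length (filter P? (concatMap f xs)) ≡ length xs ℕ.* k
  length-filter-concatMap f count [] = refl
  length-filter-concatMap f {k} count (x ∷ xs) = begin
    length (filter P? (f x ++ concatMap f xs))
      ≡⟨ cong length (filter-++ P? (f x) (concatMap f xs)) ⟩
    length (filter P? (f x) ++ filter P? (concatMap f xs))
      ≡⟨ length-++ (filter P? (f x)) ⟩
    length (filter P? (f x)) ℕ.+ length (filter P? (concatMap f xs))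
      ≡⟨ cong₂ ℕ._+_ (count x) (length-filter-concatMap f count xs) ⟩
    k ℕ.+ length xs ℕ.* k ∎
    where open ≡-Reasoning

∃!-transport : ∀ {a b ℓ} {A : Set a} {B : Set b} (e : A ↔ B) {P : Pred B ℓ} →
  ∃! _≡_ P → ∃! _≡_ (P ∘ Inverse.to e)
∃!-transport e {P} (y , Py , unique) =
  Inverse.from e y ,
  subst P (sym (Inverse.strictlyInverseˡ e y)) Py ,
  λ {x} Px → trans (cong (Inverse.from e) (unique Px)) (Inverse.strictlyInverseʳ e x)

module FiniteFieldProperties {q : ℕ} (F : FiniteField q) where
  open FiniteField F
  open Counting

  ring : CommutativeRing _ _
  ring = record { isCommutativeRing = isCommutativeRing }

  open CommutativeRing ring
    using (+-group; commutativeSemiring; *-assoc; *-comm; *-identityˡ; *-identityʳ; zeroʳ; distribˡ)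
  open import Algebra.Properties.Group +-group
    using (x∙y⁻¹≈ε⇒x≈y; //-rightDividesˡ; \\-leftDividesˡ; \\-leftDividesʳ)
    renaming (∙-cancelʳ to +-cancelʳ)
  open import Algebra.Solver.Ring.NaturalCoefficients.Default commutativeSemiring
  open ≡-Reasoning

  private
    to : Fin q → Carrier
    to = Inverse.to enumeration

  ⁻¹-cancelˡ : ∀ {x} y → x ≢ 0# → x ⁻¹ * (x * y) ≡ y
  ⁻¹-cancelˡ {x} y x≢0 = begin
    x ⁻¹ * (x * y)  ≡⟨ sym (*-assoc (x ⁻¹) x y) ⟩
    x ⁻¹ * x * y    ≡⟨ cong (_* y) (trans (*-comm (x ⁻¹) x) (⁻¹-inverse x x≢0)) ⟩
    1# * y          ≡⟨ *-identityˡ y ⟩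
    y               ∎

  ⁻¹-cancelʳ : ∀ {x} y → x ≢ 0# → x * (x ⁻¹ * y) ≡ y
  ⁻¹-cancelʳ {x} y x≢0 = begin
    x * (x ⁻¹ * y)  ≡⟨ sym (*-assoc x (x ⁻¹) y) ⟩
    x * x ⁻¹ * y    ≡⟨ cong (_* y) (⁻¹-inverse x x≢0) ⟩
    1# * y          ≡⟨ *-identityˡ y ⟩
    y               ∎

  *-nonzero : ∀ {x y} → x ≢ 0# → y ≢ 0# → x * y ≢ 0#
  *-nonzero {x} {y} x≢0 y≢0 xy≡0 = y≢0 (begin
    y               ≡⟨ sym (⁻¹-cancelˡ y x≢0) ⟩
    x ⁻¹ * (x * y)  ≡⟨ cong (x ⁻¹ *_) xy≡0 ⟩
    x ⁻¹ * 0#       ≡⟨ zeroʳ (x ⁻¹) ⟩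
    0#              ∎)

  1-x≢0 : ∀ {x} → x ≢ 1# → 1# - x ≢ 0#
  1-x≢0 {x} x≢1 1-x≡0 = x≢1 (sym (x∙y⁻¹≈ε⇒x≈y 1# x 1-x≡0))

  1^n≡1 : ∀ n → 1# ^ᶠ n ≡ 1#
  1^n≡1 ℕ.zero = refl
  1^n≡1 (ℕ.suc n) = trans (cong (1# *_) (1^n≡1 n)) (*-identityˡ 1#)

  linear-unique : ∀ {k} u v → k ≢ 0# → ∃! _≡_ (λ z → u + k * z ≡ v)
  linear-unique {k} u v k≢0 = z₀ , solves , unique
    where
    z₀ : Carrier
    z₀ = k ⁻¹ * (- u + v)
    solves : u + k * z₀ ≡ v
    solves = trans (cong (λ w → u + w) (⁻¹-cancelʳ (- u + v) k≢0)) (\\-leftDividesˡ u v)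
    unique : ∀ {z} → u + k * z ≡ v → z₀ ≡ z
    unique {z} eq = begin
      k ⁻¹ * (- u + v)           ≡⟨ cong (λ w → k ⁻¹ * (- u + w)) (sym eq) ⟩
      k ⁻¹ * (- u + (u + k * z)) ≡⟨ cong (k ⁻¹ *_) (\\-leftDividesʳ u (k * z)) ⟩
      k ⁻¹ * (k * z)             ≡⟨ ⁻¹-cancelˡ z k≢0 ⟩
      z                          ∎

  length-elements : length elements ≡ q
  length-elements = trans (length-map to (allFin q)) (length-tabulate id)

  length-filter-map-elements-unique : ∀ {a} {A : Set a} {P : Pred A a} (P? : Decidable P)
    (g : Carrier → A) → ∃! _≡_ (P ∘ g) → length (filter P? (map g elements)) ≡ 1
  length-filter-map-elements-unique P? g unique = begin
    length (filter P? (map g (map to (tabulate id))))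
      ≡⟨ cong (λ xs → length (filter P? (map g xs))) (map-tabulate id to) ⟩
    length (filter P? (map g (tabulate to)))
      ≡⟨ cong (length ∘ filter P?) (map-tabulate to g) ⟩
    length (filter P? (tabulate (g ∘ to)))
      ≡⟨ length-filter-tabulate-unique P? (g ∘ to) (∃!-transport enumeration unique) ⟩
    1 ∎

  length-filter-triples-unique : {P : Pred (Carrier × Carrier × Carrier) _} (P? : Decidable P) →
    (∀ x y → ∃! _≡_ (λ z → P (x , y , z))) → length (filter P? triples) ≡ q ^ 2
  length-filter-triples-unique P? unique = begin
    length (filter P? triples)    ≡⟨ length-filter-concatMap P? _ per-x elements ⟩
    length elements ℕ.* (q ℕ.* 1) ≡⟨ cong (ℕ._* (q ℕ.* 1)) length-elements ⟩
    q ^ 2                         ∎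
    where
    per-x : ∀ x → length (filter P? (concatMap (λ y → map (λ z → x , y , z) elements) elements)) ≡ q ℕ.* 1
    per-x x = trans
      (length-filter-concatMap P? _ (λ y → length-filter-map-elements-unique P? _ (unique x y)) elements)
      (cong (ℕ._* 1) length-elements)

  private
    isZero : Carrier → Fin 2
    isZero x with x ≟ 0#
    ... | yes _ = zero
    ... | no  _ = suc zero

    units≡1⇒isZero-injective : (∀ x → x ≢ 0# → x ≡ 1#) → ∀ {x y} → isZero x ≡ isZero y → x ≡ y
    units≡1⇒isZero-injective units≡1 {x} {y} eq with x ≟ 0# | y ≟ 0# | eq
    ... | yes x≡0 | yes y≡0 | _  = trans x≡0 (sym y≡0)
    ... | no  x≢0 | no  y≢0 | _  = trans (units≡1 x x≢0) (sym (units≡1 y y≢0))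
    ... | yes _   | no  _   | ()
    ... | no  _   | yes _   | ()

  2<q⇒¬units≡1 : 2 < q → ¬ (∀ x → x ≢ 0# → x ≡ 1#)
  2<q⇒¬units≡1 2<q units≡1 with pigeonhole 2<q (isZero ∘ to)
  ... | i , j , i<j , eq =
    <⇒≢ i<j (Injection.injective (↔⇒↣ enumeration) (units≡1⇒isZero-injective units≡1 eq))

  generator≢1 : ∀ {β} → 2 < q → IsGenerator β → β ≢ 1#
  generator≢1 2<q (_ , generates) β≡1 = 2<q⇒¬units≡1 2<q units≡1
    where
    units≡1 : ∀ x → x ≢ 0# → x ≡ 1#
    units≡1 x x≢0 with generates x x≢0
    ... | k , βᵏ≡x = trans (sym βᵏ≡x) (trans (cong (_^ᶠ k) β≡1) (1^n≡1 k))

  module AffineOperation (f : Carrier → Carrier) (β c : Carrier) where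

    infixl 6 _∗_
    _∗_ : Carrier → Carrier → Carrier
    x ∗ y = f x + β * y + c

    β≡β[1-β]+β² : β ≡ β * (1# - β) + β * β
    β≡β[1-β]+β² = begin
      β                       ≡⟨ sym (*-identityʳ β) ⟩
      β * 1#                  ≡⟨ cong (β *_) (sym (//-rightDividesˡ β 1#)) ⟩
      β * ((1# - β) + β)      ≡⟨ distribˡ β (1# - β) β ⟩
      β * (1# - β) + β * β    ∎

    -- Splitting β = β (1 − β) + β² on the left makes β² z a summand of both sides.
    assoc⇔linear : ∀ x y z →
      (x ∗ y) ∗ z ≡ x ∗ (y ∗ z) ⇔ (f (x ∗ y) + c) + β * (1# - β) * z ≡ f x + β * (f y + c) + c
    assoc⇔linear x y z = mk⇔
      (λ eq → +-cancelʳ (β * β * z) _ _ (trans (sym lhs) (trans eq rhs)))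
      (λ eq → trans lhs (trans (cong (_+ β * β * z) eq) (sym rhs)))
      where
      lhs : (x ∗ y) ∗ z ≡ (f (x ∗ y) + c) + β * (1# - β) * z + β * β * z
      lhs = begin
        f (x ∗ y) + β * z + c
          ≡⟨ regroup (f (x ∗ y)) β c z ⟩
        (f (x ∗ y) + c) + β * z
          ≡⟨ cong (λ b → (f (x ∗ y) + c) + b * z) β≡β[1-β]+β² ⟩
        (f (x ∗ y) + c) + (β * (1# - β) + β * β) * z
          ≡⟨ split (f (x ∗ y) + c) (β * (1# - β)) (β * β) z ⟩
        (f (x ∗ y) + c) + β * (1# - β) * z + β * β * z ∎
        where
        regroup : ∀ a b c z → a + b * z + c ≡ (a + c) + b * z
        regroup = solve 4 (λ a b c z → a :+ b :* z :+ c := (a :+ c) :+ b :* z) refl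
        split : ∀ a d e z → a + (d + e) * z ≡ a + d * z + e * z
        split = solve 4 (λ a d e z → a :+ (d :+ e) :* z := a :+ d :* z :+ e :* z) refl
      rhs : x ∗ (y ∗ z) ≡ f x + β * (f y + c) + c + β * β * z
      rhs = expand (f x) (f y) β c z
        where
        expand : ∀ a b β c z → a + β * (b + β * z + c) + c ≡ a + β * (b + c) + c + β * β * z
        expand = solve 5 (λ a b β c z →
          a :+ β :* (b :+ β :* z :+ c) :+ c := a :+ β :* (b :+ c) :+ c :+ β :* β :* z) refl

    assoc-unique : β ≢ 0# → β ≢ 1# → ∀ x y → ∃! _≡_ (λ z → (x ∗ y) ∗ z ≡ x ∗ (y ∗ z))
    assoc-unique β≢0 β≢1 x y with linear-unique _ _ (*-nonzero β≢0 (1-x≢0 β≢1))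
    ... | z₀ , solves , unique =
      z₀ , Equivalence.from (assoc⇔linear x y z₀) solves ,
      λ {z} assoc → unique (Equivalence.to (assoc⇔linear x y z) assoc)

    numAssociativeTriples≡q² : β ≢ 0# → β ≢ 1# → numAssociativeTriples _∗_ ≡ q ^ 2
    numAssociativeTriples≡q² β≢0 β≢1 = length-filter-triples-unique _ (assoc-unique β≢0 β≢1)

theorem8 : (p r : ℕ) → Prime p → 2 < p ^ r →
    (F : FiniteField (p ^ r)) →
    let open FiniteField F in
    (β : Carrier) → IsGenerator β →
    (m : ℕ) → 1 < m → m < p ^ r ∸ 1 → Coprime m (p ^ r ∸ 1) →
    (∀ l → l < r → ¬ ((+ (p ^ r ∸ 1)) ∣ ((+ m) -ℤ (+ (p ^ l))))) →
    (c : Carrier) → c ≢ 0# →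
    ¬ (∃ λ x → (x ^ᶠ m) - x + c * ((1# - β) ⁻¹) ≡ 0#) →
    numAssociativeTriples (λ x y → (1# - β) * (x ^ᶠ m) + β * y + c) ≡ (p ^ r) ^ 2
theorem8 p r _ 2<q F β generator@(β≢0 , _) m _ _ _ _ c _ _ =
  numAssociativeTriples≡q² β≢0 (generator≢1 2<q generator)
  where
  open FiniteField F
  open FiniteFieldProperties F
  open AffineOperation (λ x → (1# - β) * (x ^ᶠ m)) β c
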